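{- Let $G$ be an edge-coloured digraph (in the sense of the context). Then, in the Hopf algebra $\mathrm{QSym}(x)$, $$\Delta(\mathscr{X}_{G}(x))=\sum_{F} \mathscr{X}_{G|_{V(G)-V(F)}}(x)\otimes \mathscr{X}_{F}(x),$$ where the sum runs over all $\{\rightarrow,\Rightarrow\}$-induced subdigraphs $F$ of $G$ (including $F=\emptyset$ and $F=G$; the generalized chromatic function of the empty digraph is $1$).
   Context: A simple digraph has no loops and, for distinct vertices $a,b$, at most one directed edge from $a$ to $b$. An edge-coloured digraph is a finite simple digraph $G$ in which every edge has one of three colours, written $a\dashrightarrow b$ (dashed), $a\rightarrow b$ (solid), $a\Rightarrow b$ (double). A proper vertex-colouring of $G$ is a map $\kappa:V(G)\to\mathbb{P}=\{1,2,\dots\}$ such that for every edge $(a,b)$: if $a\dashrightarrow b$ then $\kappa(a)\neq\kappa(b)$; if $a\rightarrow b$ then $\kappa(a)<\kappa(b)$; if $a\Rightarrow b$ then $\kappa(a)\le\kappa(b)$. Let $\mathcal{C}(G)$ be the set of proper vertex-colourings. The generalized chromatic function is $\mathscr{X}_G(x)=\sum_{\kappa\in\mathcal{C}(G)}\prod_{a\in V(G)}x_{\kappa(a)}$ in commuting variables $x_1,x_2,\dots$ (it is a quasisymmetric function). For $A\subseteq V(G)$, $G|_A$ is the induced subdigraph on $A$ with the edge colours inherited from $G$. An induced subdigraph $F$ of $G$ is a $\{\rightarrow,\Rightarrow\}$-induced subdigraph if whenever $a\in V(F)$ and $a\rightarrow b$ or $a\Rightarrow b$ in $G$, then $b\in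 V(F)$. $\mathrm{QSym}(x)$ is the Hopf algebra of quasisymmetric functions; its coproduct $\Delta$ is defined by taking $f(x_1,x_2,\dots)$ to $f(x_1,x_2,\dots,y_1,y_2,\dots)$ with the variables ordered $x_1<x_2<\cdots<y_1<y_2<\cdots$, regarding the result as an element of $\mathrm{QSym}(x)\otimes\mathrm{QSym}(y)$ (identifying $f\otimes g$ with $fg$), and then identifying $\mathrm{QSym}(y)$ with $\mathrm{QSym}(x)$. -}

module Defs where

open import Data.Nat using (ℕ; zero; suc; _+_; _*_)
import Data.Nat.Properties as ℕP
open import Data.Bool using (Bool; true; false)
open import Data.Fin using (Fin; zero; suc; _<_; _≤_)
open import Data.Fin.Properties using (_≟_; _<?_; _≤?_; all?)
open import Data.Fin.Subset using (Subset; _∈_; ∁)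
open import Data.Fin.Subset.Properties using (_∈?_)
open import Data.Vec using (Vec; []; _∷_)
import Data.Vec as Vec
import Data.Vec.Functional as VF
open import Data.Maybe using (Maybe; just; nothing)
open import Data.List using (List; []; _∷_; [_]; map; concatMap; allFin; filter; length)
open import Data.Nat.ListAction using (sum)
open import Data.Product using (_×_; _,_)
open import Data.Sum using (_⊎_)
open import Data.Unit using (⊤; tt)
open import Relation.Nullary using (¬_; Dec; yes; no; _×-dec_; _⊎-dec_; ¬?)
open import Relation.Binary.PropositionalEquality using (_≡_; refl)

data EdgeColour : Set where
  dashed solid double : EdgeColour

-- E a b = just c  means there is an edge a → b of colour c;  nothing = no edge.
-- (A function automatically gives at most one edge from a to b.)
record ECDigraph : Set where
  field
    n        : ℕ
    E        : Fin n → Fin n → Maybe EdgeColour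
    loopless : ∀ a → E a a ≡ nothing
open ECDigraph public

-- Colours: Fin m, index i standing for the colour / variable i+1, with the
-- usual order.  Condition imposed on an edge of given colour.
EdgeOK : ∀ {m} → Maybe EdgeColour → Fin m → Fin m → Set
EdgeOK nothing       i j = ⊤
EdgeOK (just dashed) i j = ¬ (i ≡ j)
EdgeOK (just solid)  i j = i < j
EdgeOK (just double) i j = i ≤ j

EdgeOK? : ∀ {m} (e : Maybe EdgeColour) (i j : Fin m) → Dec (EdgeOK e i j)
EdgeOK? nothing       i j = yes tt
EdgeOK? (just dashed) i j = ¬? (i ≟ j)
EdgeOK? (just solid)  i j = i <? j
EdgeOK? (just double) i j = i ≤? j

Proper : ∀ (G : ECDigraph) {m} → (Fin (n G) → Fin m) → Set
Proper G κ = ∀ a b → EdgeOK (E G a b) (κ a) (κ b)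

Proper? : ∀ (G : ECDigraph) {m} (κ : Fin (n G) → Fin m) → Dec (Proper G κ)
Proper? G κ = all? (λ a → all? (λ b → EdgeOK? (E G a b) (κ a) (κ b)))

fibre : ∀ {n m} → (Fin n → Fin m) → Fin m → ℕ
fibre {n} κ i = length (filter (λ a → κ a ≟ i) (allFin n))

-- κ contributes the monomial x^α = ∏ x_{i+1}^{α i}.
HasContent : ∀ {n m} → (Fin n → Fin m) → (Fin m → ℕ) → Set
HasContent κ α = ∀ i → fibre κ i ≡ α i

HasContent? : ∀ {n m} (κ : Fin n → Fin m) (α : Fin m → ℕ) → Dec (HasContent κ α)
HasContent? κ α = all? (λ i → fibre κ i ℕP.≟ α i)

consF : ∀ {n m} → Fin m → (Fin n → Fin m) → Fin (suc n) → Fin m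
consF c f zero    = c
consF c f (suc i) = f i

allFuns : ∀ n m → List (Fin n → Fin m)
allFuns zero    m = [ (λ ()) ]
allFuns (suc n) m = concatMap (λ f → map (λ c → consF c f) (allFin m)) (allFuns n m)

-- Coefficient of the monomial x_1^{α 0} ⋯ x_m^{α (m-1)} in the generalized
-- chromatic function 𝒳_G(x): the number of proper colourings with that content.
-- (Any monomial has finite support, so every coefficient is of this form.)
coeffX : ∀ (G : ECDigraph) {m} → (Fin m → ℕ) → ℕ
coeffX G {m} α =
  length (filter (λ κ → Proper? G κ ×-dec HasContent? κ α) (allFuns (n G) m))

-- Coefficient of x_1^{α 0}⋯x_m^{α(m-1)} y_1^{β 0}⋯y_k^{β(k-1)} in
-- Δ(𝒳_G) = 𝒳_G(x_1,x_2,…,y_1,y_2,…) with x_1<x_2<⋯<y_1<y_2<⋯ :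
-- the alphabet x_1<⋯<x_m<y_1<⋯<y_k is Fin (m + k) with its order.
ΔcoeffX : ∀ (G : ECDigraph) {m k} → (Fin m → ℕ) → (Fin k → ℕ) → ℕ
ΔcoeffX G α β = coeffX G (α VF.++ β)

size : ∀ {n} → Subset n → ℕ
size []          = 0
size (true ∷ A)  = suc (size A)
size (false ∷ A) = size A

emb : ∀ {n} (A : Subset n) → Fin (size A) → Fin n
emb (true ∷ A)  zero    = zero
emb (true ∷ A)  (suc i) = suc (emb A i)
emb (false ∷ A) i       = suc (emb A i)

restrict : (G : ECDigraph) → Subset (n G) → ECDigraph
restrict G A = record
  { n = size A
  ; E = λ i j → E G (emb A i) (emb A j)
  ; loopless = λ i → loopless G (emb A i)
  }

-- A is the vertex set of a {→,⇒}-induced subdigraph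
SolidOrDouble : Maybe EdgeColour → Set
SolidOrDouble e = (e ≡ just solid) ⊎ (e ≡ just double)

SolidOrDouble? : (e : Maybe EdgeColour) → Dec (SolidOrDouble e)
SolidOrDouble? nothing       = no (λ { (Data.Sum.inj₁ ()) ; (Data.Sum.inj₂ ()) })
SolidOrDouble? (just dashed) = no (λ { (Data.Sum.inj₁ ()) ; (Data.Sum.inj₂ ()) })
SolidOrDouble? (just solid)  = yes (Data.Sum.inj₁ refl)
SolidOrDouble? (just double) = yes (Data.Sum.inj₂ refl)

ArrowClosed : (G : ECDigraph) → Subset (n G) → Set
ArrowClosed G A = ∀ a b → a ∈ A → SolidOrDouble (E G a b) → b ∈ A

ArrowClosed? : (G : ECDigraph) (A : Subset (n G)) → Dec (ArrowClosed G A)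
ArrowClosed? G A = all? (λ a → all? (λ b → imp (a ∈? A) (imp (SolidOrDouble? (E G a b)) (b ∈? A))))
  where
    imp : ∀ {P Q : Set} → Dec P → Dec Q → Dec (P → Q)
    imp _       (yes q) = yes (λ _ → q)
    imp (no ¬p) _       = yes (λ p → Data.Empty.⊥-elim (¬p p))
      where import Data.Empty
    imp (yes p) (no ¬q) = no (λ f → ¬q (f p))

allSubsets : ∀ n → List (Subset n)
allSubsets zero    = [ [] ]
allSubsets (suc n) = concatMap (λ A → (true Vec.∷ A) ∷ (false Vec.∷ A) ∷ []) (allSubsets n)

-- Coefficient of x^α y^β in  Σ_F 𝒳_{G|_{V-V(F)}}(x) 𝒳_F(y)  (f ⊗ g identified with f(x)g(y)),
-- F ranging over the {→,⇒}-induced subdigraphs (given by their vertex sets).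
RHScoeff : ∀ (G : ECDigraph) {m k} → (Fin m → ℕ) → (Fin k → ℕ) → ℕ
RHScoeff G α β =
  sum (map (λ A → coeffX (restrict G (∁ A)) α * coeffX (restrict G A) β)
           (filter (ArrowClosed? G) (allSubsets (n G))))

-- A colouring κ of G by x₁ < ⋯ < x_m < y₁ < ⋯ < y_k is the same thing as a set A of
-- vertices (those coloured by y's), a colouring κ₁ of the complement of A by the x's and a
-- colouring κ₂ of A by the y's.  Every edge between A and its complement going up from
-- x's to y's is satisfied, every dashed edge between them too, and a solid or double edge
-- from A to its complement would have to go down from a y to an x; so κ is proper exactly
-- when κ₁ and κ₂ are proper and A is closed under solid and double edges.  The content of
-- κ is that of κ₁ followed by that of κ₂, and counting by A gives the coefficient identity.

module Submission where

open import Defs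
open import Data.Nat using (ℕ; zero; suc; _+_; _*_; _<_; _≤_)
import Data.Nat.Properties as ℕ
open import Data.Bool using (true; false)
open import Data.Fin using (Fin; zero; suc; toℕ; _↑ˡ_; _↑ʳ_; splitAt)
import Data.Fin as Fin
open import Data.Fin.Properties
  using (_≟_; <⇒≢; toℕ-injective; toℕ<n; toℕ-↑ˡ; toℕ-↑ʳ; ↑ˡ-injective; ↑ʳ-injective; splitAt⁻¹-↑ˡ; splitAt⁻¹-↑ʳ)
open import Data.Fin.Subset using (Subset; _∈_; ∁)
open import Data.Vec using ([]; _∷_; here; there)
open import Data.Vec.Functional using (_++_)
open import Data.Vec.Functional.Properties using (lookup-++ˡ; lookup-++ʳ)
open import Data.List using (List; []; _∷_; map; concatMap; allFin; filter; length; tabulate)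
import Data.List as List
open import Data.Nat.ListAction using (sum)
open import Data.Maybe using (just; nothing)
open import Data.Product using (_×_; _,_; ∃)
open import Data.Sum using (_⊎_; inj₁; inj₂)
open import Data.Unit using (tt)
open import Data.Empty using (⊥-elim)
open import Relation.Nullary using (¬_; Dec; yes; no; _×-dec_)
open import Relation.Unary using (Pred; Decidable)
open import Relation.Binary using (_Preserves_⟶_)
open import Function using (_∘_)
open import Relation.Binary.PropositionalEquality
  using (_≡_; _≗_; refl; sym; trans; cong; cong₂; subst₂; module ≡-Reasoning)
open import Algebra.Properties.Semiring.Sum ℕ.+-*-semiring
  using (sum-syntax; sum-cong-≗; sum-replicate-zero; ∑-distrib-+) renaming (sum to ∑)
open import Algebra.Properties.CommutativeSemigroup ℕ.+-commutativeSemigroup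
  using () renaming (interchange to +-interchange)

open ≡-Reasoning

𝟙 : ∀ {p} {P : Set p} → Dec P → ℕ
𝟙 (yes _) = 1
𝟙 (no _)  = 0

𝟙-cong : ∀ {p q} {P : Set p} {Q : Set q} → (P → Q) → (Q → P) → (P? : Dec P) (Q? : Dec Q) → 𝟙 P? ≡ 𝟙 Q?
𝟙-cong to from (yes p) (yes q) = refl
𝟙-cong to from (yes p) (no ¬q) = ⊥-elim (¬q (to p))
𝟙-cong to from (no ¬p) (yes q) = ⊥-elim (¬p (from q))
𝟙-cong to from (no ¬p) (no ¬q) = refl

𝟙-no : ∀ {p} {P : Set p} → ¬ P → (P? : Dec P) → 𝟙 P? ≡ 0
𝟙-no ¬p (yes p) = ⊥-elim (¬p p)
𝟙-no ¬p (no _)  = refl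

𝟙-× : ∀ {p q} {P : Set p} {Q : Set q} (P? : Dec P) (Q? : Dec Q) → 𝟙 (P? ×-dec Q?) ≡ 𝟙 P? * 𝟙 Q?
𝟙-× (yes p) (yes q) = refl
𝟙-× (yes p) (no ¬q) = refl
𝟙-× (no ¬p) Q?      = refl

module _ {a} {A : Set a} where

  ∑ₗ : List A → (A → ℕ) → ℕ
  ∑ₗ xs f = sum (map f xs)

  infixl 10 ∑ₗ
  syntax ∑ₗ xs (λ x → e) = ∑[ x ← xs ] e

  ∑ₗ-cong : ∀ (xs : List A) {f g : A → ℕ} → f ≗ g → ∑ₗ xs f ≡ ∑ₗ xs g
  ∑ₗ-cong []       f≗g = refl
  ∑ₗ-cong (x ∷ xs) f≗g = cong₂ _+_ (f≗g x) (∑ₗ-cong xs f≗g)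

  ∑ₗ-++ : ∀ (xs ys : List A) (f : A → ℕ) → ∑ₗ (xs List.++ ys) f ≡ ∑ₗ xs f + ∑ₗ ys f
  ∑ₗ-++ []       ys f = refl
  ∑ₗ-++ (x ∷ xs) ys f = trans (cong (f x +_) (∑ₗ-++ xs ys f)) (sym (ℕ.+-assoc (f x) _ _))

  ∑ₗ-distrib-+ : ∀ (xs : List A) (f g : A → ℕ) → ∑[ x ← xs ] (f x + g x) ≡ ∑ₗ xs f + ∑ₗ xs g
  ∑ₗ-distrib-+ []       f g = refl
  ∑ₗ-distrib-+ (x ∷ xs) f g =
    trans (cong (f x + g x +_) (∑ₗ-distrib-+ xs f g)) (+-interchange (f x) (g x) _ _)

  *-distribˡ-∑ₗ : ∀ c (xs : List A) (f : A → ℕ) → c * ∑ₗ xs f ≡ ∑[ x ← xs ] (c * f x)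
  *-distribˡ-∑ₗ c []       f = ℕ.*-zeroʳ c
  *-distribˡ-∑ₗ c (x ∷ xs) f = trans (ℕ.*-distribˡ-+ c (f x) _) (cong (c * f x +_) (*-distribˡ-∑ₗ c xs f))

  *-distribʳ-∑ₗ : ∀ c (xs : List A) (f : A → ℕ) → ∑ₗ xs f * c ≡ ∑[ x ← xs ] (f x * c)
  *-distribʳ-∑ₗ c []       f = refl
  *-distribʳ-∑ₗ c (x ∷ xs) f = trans (ℕ.*-distribʳ-+ c (f x) _) (cong (f x * c +_) (*-distribʳ-∑ₗ c xs f))

  ∑ₗ-comm-∑ : ∀ (xs : List A) n (f : A → Fin n → ℕ) → ∑[ x ← xs ] ∑ (f x) ≡ ∑[ i < n ] ∑[ x ← xs ] f x i
  ∑ₗ-comm-∑ []       n f = sym (sum-replicate-zero n)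
  ∑ₗ-comm-∑ (x ∷ xs) n f = trans (cong (∑ (f x) +_) (∑ₗ-comm-∑ xs n f)) (sym (∑-distrib-+ (f x) _))

  module _ {p} {P : Pred A p} (P? : Decidable P) where

    ∑ₗ-filter : ∀ (xs : List A) (f : A → ℕ) → ∑ₗ (filter P? xs) f ≡ ∑[ x ← xs ] (𝟙 (P? x) * f x)
    ∑ₗ-filter []       f = refl
    ∑ₗ-filter (x ∷ xs) f with P? x
    ... | yes _ = cong₂ _+_ (sym (ℕ.+-identityʳ (f x))) (∑ₗ-filter xs f)
    ... | no _  = ∑ₗ-filter xs f

    length-filter : ∀ (xs : List A) → length (filter P? xs) ≡ ∑[ x ← xs ] 𝟙 (P? x)
    length-filter []       = refl
    length-filter (x ∷ xs) with P? x
    ... | yes _ = cong suc (length-filter xs)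
    ... | no _  = length-filter xs

module _ {a b} {A : Set a} {B : Set b} where

  ∑ₗ-map : ∀ (g : A → B) (xs : List A) (f : B → ℕ) → ∑ₗ (map g xs) f ≡ ∑[ x ← xs ] f (g x)
  ∑ₗ-map g []       f = refl
  ∑ₗ-map g (x ∷ xs) f = cong (f (g x) +_) (∑ₗ-map g xs f)

  ∑ₗ-concatMap : ∀ (g : A → List B) (xs : List A) (f : B → ℕ) → ∑ₗ (concatMap g xs) f ≡ ∑[ x ← xs ] ∑ₗ (g x) f
  ∑ₗ-concatMap g []       f = refl
  ∑ₗ-concatMap g (x ∷ xs) f = trans (∑ₗ-++ (g x) (concatMap g xs) f) (cong (∑ₗ (g x) f +_) (∑ₗ-concatMap g xs f))

  ∑ₗ-*-∑ₗ : ∀ (xs : List A) (ys : List B) (f : A → ℕ) (g : B → ℕ) →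
    ∑[ x ← xs ] ∑[ y ← ys ] (f x * g y) ≡ ∑ₗ xs f * ∑ₗ ys g
  ∑ₗ-*-∑ₗ xs ys f g = begin
    ∑[ x ← xs ] ∑[ y ← ys ] (f x * g y)  ≡⟨ ∑ₗ-cong xs (λ x → sym (*-distribˡ-∑ₗ (f x) ys g)) ⟩
    ∑[ x ← xs ] (f x * ∑ₗ ys g)          ≡⟨ sym (*-distribʳ-∑ₗ (∑ₗ ys g) xs f) ⟩
    ∑ₗ xs f * ∑ₗ ys g                    ∎

∑ₗ-tabulate : ∀ {a} {A : Set a} n (g : Fin n → A) (f : A → ℕ) → ∑ₗ (tabulate g) f ≡ ∑[ i < n ] f (g i)
∑ₗ-tabulate zero    g f = refl
∑ₗ-tabulate (suc n) g f = cong (f (g zero) +_) (∑ₗ-tabulate n (λ i → g (suc i)) f)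

∑-↑ : ∀ m k (f : Fin (m + k) → ℕ) → ∑ f ≡ ∑[ i < m ] f (i ↑ˡ k) + ∑[ j < k ] f (m ↑ʳ j)
∑-↑ zero    k f = refl
∑-↑ (suc m) k f = trans (cong (f zero +_) (∑-↑ m k (λ i → f (suc i)))) (sym (ℕ.+-assoc (f zero) _ _))

consF-cong : ∀ {n M} (c : Fin M) {f g : Fin n → Fin M} → f ≗ g → consF c f ≗ consF c g
consF-cong c f≗g zero    = refl
consF-cong c f≗g (suc i) = f≗g i

∑ₗ-allFuns-suc : ∀ n M (w : (Fin (suc n) → Fin M) → ℕ) →
  ∑ₗ (allFuns (suc n) M) w ≡ ∑[ f ← allFuns n M ] ∑[ c < M ] w (consF c f)
∑ₗ-allFuns-suc n M w = trans (∑ₗ-concatMap _ (allFuns n M) w) (∑ₗ-cong (allFuns n M) λ f →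
  trans (∑ₗ-map (λ c → consF c f) (allFin M) w) (∑ₗ-tabulate M (λ c → c) (λ c → w (consF c f))))

module _ {m k : ℕ} where

  glue : ∀ {n} (A : Subset n) → (Fin (size (∁ A)) → Fin m) → (Fin (size A) → Fin k) → Fin n → Fin (m + k)
  glue []          κ₁ κ₂ = λ ()
  glue (true ∷ A)  κ₁ κ₂ = consF (m ↑ʳ κ₂ zero) (glue A κ₁ (λ i → κ₂ (suc i)))
  glue (false ∷ A) κ₁ κ₂ = consF (κ₁ zero ↑ˡ k) (glue A (λ i → κ₁ (suc i)) κ₂)

  ∑-glue : ∀ {n} (A : Subset n) → ((Fin n → Fin (m + k)) → ℕ) → ℕ
  ∑-glue A w = ∑[ κ₁ ← allFuns (size (∁ A)) m ] ∑[ κ₂ ← allFuns (size A) k ] w (glue A κ₁ κ₂)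

  module _ {n} (A : Subset n) where

    ∑-glue-cong : ∀ {w w′ : (Fin n → Fin (m + k)) → ℕ} → w ≗ w′ → ∑-glue A w ≡ ∑-glue A w′
    ∑-glue-cong w≡w′ = ∑ₗ-cong (allFuns (size (∁ A)) m) λ κ₁ → ∑ₗ-cong (allFuns (size A) k) λ κ₂ → w≡w′ _

    ∑-glue-distrib-+ : ∀ (w w′ : (Fin n → Fin (m + k)) → ℕ) → ∑-glue A (λ f → w f + w′ f) ≡ ∑-glue A w + ∑-glue A w′
    ∑-glue-distrib-+ w w′ = trans
      (∑ₗ-cong (allFuns (size (∁ A)) m) λ κ₁ → ∑ₗ-distrib-+ (allFuns (size A) k) _ _)
      (∑ₗ-distrib-+ (allFuns (size (∁ A)) m) _ _)

    ∑-glue-true : ∀ w → ∑-glue (true ∷ A) w ≡ ∑-glue A (λ f → ∑[ j < k ] w (consF (m ↑ʳ j) f))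
    ∑-glue-true w = ∑ₗ-cong (allFuns (size (∁ A)) m) λ κ₁ → ∑ₗ-allFuns-suc (size A) k _

    ∑-glue-false : ∀ w → ∑-glue (false ∷ A) w ≡ ∑-glue A (λ f → ∑[ i < m ] w (consF (i ↑ˡ k) f))
    ∑-glue-false w = trans (∑ₗ-allFuns-suc (size (∁ A)) m _)
      (∑ₗ-cong (allFuns (size (∁ A)) m) λ κ₁ → sym (∑ₗ-comm-∑ (allFuns (size A) k) m _))

    ∑-glue-suc : ∀ w → ∑-glue (true ∷ A) w + ∑-glue (false ∷ A) w ≡ ∑-glue A (λ f → ∑[ c < m + k ] w (consF c f))
    ∑-glue-suc w = begin
      ∑-glue (true ∷ A) w + ∑-glue (false ∷ A) w  ≡⟨ cong₂ _+_ (∑-glue-true w) (∑-glue-false w) ⟩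
      ∑-glue A wʳ + ∑-glue A wˡ                    ≡⟨ sym (∑-glue-distrib-+ wʳ wˡ) ⟩
      ∑-glue A (λ f → wʳ f + wˡ f)
        ≡⟨ ∑-glue-cong {w′ = w⁺} (λ f → trans (ℕ.+-comm (wʳ f) _) (sym (∑-↑ m k (λ c → w (consF c f))))) ⟩
      ∑-glue A w⁺                                  ∎
      where
      wˡ wʳ w⁺ : (Fin n → Fin (m + k)) → ℕ
      wˡ f = ∑[ i < m ] w (consF (i ↑ˡ k) f)
      wʳ f = ∑[ j < k ] w (consF (m ↑ʳ j) f)
      w⁺ f = ∑[ c < m + k ] w (consF c f)

  ∑-allSubsets-suc-glue : ∀ n (w : (Fin (suc n) → Fin (m + k)) → ℕ) →
    ∑[ A ← allSubsets (suc n) ] ∑-glue A w ≡ ∑[ A ← allSubsets n ] ∑-glue A (λ f → ∑[ c < m + k ] w (consF c f))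
  ∑-allSubsets-suc-glue n w = trans (∑ₗ-concatMap _ (allSubsets n) _) (∑ₗ-cong (allSubsets n) λ A →
    trans (cong (∑-glue (true ∷ A) w +_) (ℕ.+-identityʳ _)) (∑-glue-suc A w))

  -- Respect for ≗ is only needed at n = 0, where the empty function listed by allFuns and
  -- the one built by glue are different terms.
  ∑ₗ-allFuns-glue : ∀ n (w : (Fin n → Fin (m + k)) → ℕ) → w Preserves _≗_ ⟶ _≡_ →
    ∑ₗ (allFuns n (m + k)) w ≡ ∑[ A ← allSubsets n ] ∑-glue A w
  ∑ₗ-allFuns-glue zero    w w-cong =
    cong (_+ 0) (trans (w-cong (λ ())) (sym (trans (ℕ.+-identityʳ _) (ℕ.+-identityʳ _))))
  ∑ₗ-allFuns-glue (suc n) w w-cong = begin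
    ∑ₗ (allFuns (suc n) (m + k)) w                 ≡⟨ ∑ₗ-allFuns-suc n (m + k) w ⟩
    ∑ₗ (allFuns n (m + k)) w′                      ≡⟨ ∑ₗ-allFuns-glue n w′ w′-cong ⟩
    ∑[ A ← allSubsets n ] ∑-glue A w′              ≡⟨ sym (∑-allSubsets-suc-glue n w) ⟩
    ∑[ A ← allSubsets (suc n) ] ∑-glue A w         ∎
    where
    w′ : (Fin n → Fin (m + k)) → ℕ
    w′ f = ∑[ c < m + k ] w (consF c f)

    w′-cong : w′ Preserves _≗_ ⟶ _≡_
    w′-cong f≗g = sum-cong-≗ λ c → w-cong (consF-cong c f≗g)

module _ {a b} {f : Fin a → Fin b} (c : ℕ) (shift : ∀ x → toℕ (f x) ≡ c + toℕ x) where

  EdgeOK-shift : ∀ e {x y} → EdgeOK e x y → EdgeOK e (f x) (f y)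
  EdgeOK-shift nothing       _   = tt
  EdgeOK-shift (just dashed) {x} {y} x≢y fx≡fy =
    x≢y (toℕ-injective (ℕ.+-cancelˡ-≡ c _ _ (trans (sym (shift x)) (trans (cong toℕ fx≡fy) (shift y)))))
  EdgeOK-shift (just solid)  {x} {y} x<y = subst₂ _<_ (sym (shift x)) (sym (shift y)) (ℕ.+-monoʳ-< c x<y)
  EdgeOK-shift (just double) {x} {y} x≤y = subst₂ _≤_ (sym (shift x)) (sym (shift y)) (ℕ.+-monoʳ-≤ c x≤y)

  EdgeOK-unshift : ∀ e {x y} → EdgeOK e (f x) (f y) → EdgeOK e x y
  EdgeOK-unshift nothing       _   = tt
  EdgeOK-unshift (just dashed) fx≢fy x≡y = fx≢fy (cong f x≡y)
  EdgeOK-unshift (just solid)  {x} {y} fx<fy = ℕ.+-cancelˡ-< c _ _ (subst₂ _<_ (shift x) (shift y) fx<fy)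
  EdgeOK-unshift (just double) {x} {y} fx≤fy = ℕ.+-cancelˡ-≤ c _ _ (subst₂ _≤_ (shift x) (shift y) fx≤fy)

module _ {M : ℕ} where

  EdgeOK-< : ∀ e {i j : Fin M} → i Fin.< j → EdgeOK e i j
  EdgeOK-< nothing       i<j = tt
  EdgeOK-< (just dashed) i<j = <⇒≢ i<j
  EdgeOK-< (just solid)  i<j = i<j
  EdgeOK-< (just double) i<j = ℕ.<⇒≤ i<j

  EdgeOK-> : ∀ e {i j : Fin M} → j Fin.< i → ¬ SolidOrDouble e → EdgeOK e i j
  EdgeOK-> nothing       j<i _    = tt
  EdgeOK-> (just dashed) j<i _    = λ i≡j → <⇒≢ j<i (sym i≡j)
  EdgeOK-> (just solid)  j<i ¬s⊎d = ⊥-elim (¬s⊎d (inj₁ refl))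
  EdgeOK-> (just double) j<i ¬s⊎d = ⊥-elim (¬s⊎d (inj₂ refl))

  SolidOrDouble⇒≤ : ∀ {e} {i j : Fin M} → SolidOrDouble e → EdgeOK e i j → i Fin.≤ j
  SolidOrDouble⇒≤ (inj₁ refl) i<j = ℕ.<⇒≤ i<j
  SolidOrDouble⇒≤ (inj₂ refl) i≤j = i≤j

↑ˡ<↑ʳ : ∀ {m k} (i : Fin m) (j : Fin k) → i ↑ˡ k Fin.< m ↑ʳ j
↑ˡ<↑ʳ {m} {k} i j = subst₂ _<_ (sym (toℕ-↑ˡ i k)) (sym (toℕ-↑ʳ m j)) (ℕ.<-≤-trans (toℕ<n i) (ℕ.m≤m+n m (toℕ j)))

emb-or-emb∁ : ∀ {n} (A : Subset n) a → (∃ λ b → emb A b ≡ a) ⊎ (∃ λ b → emb (∁ A) b ≡ a)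
emb-or-emb∁ (true ∷ A)  zero    = inj₁ (zero , refl)
emb-or-emb∁ (false ∷ A) zero    = inj₂ (zero , refl)
emb-or-emb∁ (true ∷ A)  (suc a) with emb-or-emb∁ A a
... | inj₁ (b , refl) = inj₁ (suc b , refl)
... | inj₂ (b , refl) = inj₂ (b , refl)
emb-or-emb∁ (false ∷ A) (suc a) with emb-or-emb∁ A a
... | inj₁ (b , refl) = inj₁ (b , refl)
... | inj₂ (b , refl) = inj₂ (suc b , refl)

emb-∈ : ∀ {n} (A : Subset n) b → emb A b ∈ A
emb-∈ (true ∷ A)  zero    = here
emb-∈ (true ∷ A)  (suc b) = there (emb-∈ A b)
emb-∈ (false ∷ A) b       = there (emb-∈ A b)

emb∁-∉ : ∀ {n} (A : Subset n) b → ¬ (emb (∁ A) b ∈ A)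
emb∁-∉ (true ∷ A)  b       (there b∈A) = emb∁-∉ A b b∈A
emb∁-∉ (false ∷ A) (suc b) (there b∈A) = emb∁-∉ A b b∈A

module _ {m k : ℕ} where

  glue-emb : ∀ {n} (A : Subset n) κ₁ κ₂ b → glue {m} {k} A κ₁ κ₂ (emb A b) ≡ m ↑ʳ κ₂ b
  glue-emb (true ∷ A)  κ₁ κ₂ zero    = refl
  glue-emb (true ∷ A)  κ₁ κ₂ (suc b) = glue-emb A κ₁ (λ i → κ₂ (suc i)) b
  glue-emb (false ∷ A) κ₁ κ₂ b       = glue-emb A (λ i → κ₁ (suc i)) κ₂ b

  glue-emb∁ : ∀ {n} (A : Subset n) κ₁ κ₂ b → glue {m} {k} A κ₁ κ₂ (emb (∁ A) b) ≡ κ₁ b ↑ˡ k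
  glue-emb∁ (true ∷ A)  κ₁ κ₂ b       = glue-emb∁ A κ₁ (λ i → κ₂ (suc i)) b
  glue-emb∁ (false ∷ A) κ₁ κ₂ zero    = refl
  glue-emb∁ (false ∷ A) κ₁ κ₂ (suc b) = glue-emb∁ A (λ i → κ₁ (suc i)) κ₂ b

  module _ (G : ECDigraph) (A : Subset (n G))
           (κ₁ : Fin (size (∁ A)) → Fin m) (κ₂ : Fin (size A) → Fin k) where

    private
      γ : Fin (n G) → Fin (m + k)
      γ = glue A κ₁ κ₂

      shiftˡ : ∀ (i : Fin m) → toℕ (i ↑ˡ k) ≡ 0 + toℕ i
      shiftˡ i = toℕ-↑ˡ i k

    proper-glue⇒closed : Proper G γ → ArrowClosed G A
    proper-glue⇒closed proper a b a∈A s⊎d with emb-or-emb∁ A b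
    ... | inj₁ (b′ , refl) = emb-∈ A b′
    ... | inj₂ (b′ , refl) with emb-or-emb∁ A a
    ...   | inj₂ (a′ , refl) = ⊥-elim (emb∁-∉ A a′ a∈A)
    ...   | inj₁ (a′ , refl) = ⊥-elim (ℕ.<⇒≱ (↑ˡ<↑ʳ (κ₁ b′) (κ₂ a′))
            (subst₂ Fin._≤_ (glue-emb A κ₁ κ₂ a′) (glue-emb∁ A κ₁ κ₂ b′) (SolidOrDouble⇒≤ s⊎d (proper _ _))))

    proper-glue⇒properˡ : Proper G γ → Proper (restrict G (∁ A)) κ₁
    proper-glue⇒properˡ proper i j = EdgeOK-unshift 0 shiftˡ (E G _ _)
      (subst₂ (EdgeOK (E G _ _)) (glue-emb∁ A κ₁ κ₂ i) (glue-emb∁ A κ₁ κ₂ j) (proper _ _))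

    proper-glue⇒properʳ : Proper G γ → Proper (restrict G A) κ₂
    proper-glue⇒properʳ proper i j = EdgeOK-unshift m (toℕ-↑ʳ m) (E G _ _)
      (subst₂ (EdgeOK (E G _ _)) (glue-emb A κ₁ κ₂ i) (glue-emb A κ₁ κ₂ j) (proper _ _))

    proper-glue : ArrowClosed G A → Proper (restrict G (∁ A)) κ₁ → Proper (restrict G A) κ₂ → Proper G γ
    proper-glue closed proper₁ proper₂ a b with emb-or-emb∁ A a | emb-or-emb∁ A b
    ... | inj₁ (a′ , refl) | inj₁ (b′ , refl)
      rewrite glue-emb A κ₁ κ₂ a′ | glue-emb A κ₁ κ₂ b′ = EdgeOK-shift m (toℕ-↑ʳ m) (E G _ _) (proper₂ a′ b′)
    ... | inj₂ (a′ , refl) | inj₂ (b′ , refl)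
      rewrite glue-emb∁ A κ₁ κ₂ a′ | glue-emb∁ A κ₁ κ₂ b′ = EdgeOK-shift 0 shiftˡ (E G _ _) (proper₁ a′ b′)
    ... | inj₂ (a′ , refl) | inj₁ (b′ , refl)
      rewrite glue-emb∁ A κ₁ κ₂ a′ | glue-emb A κ₁ κ₂ b′ = EdgeOK-< (E G _ _) (↑ˡ<↑ʳ (κ₁ a′) (κ₂ b′))
    ... | inj₁ (a′ , refl) | inj₂ (b′ , refl)
      rewrite glue-emb A κ₁ κ₂ a′ | glue-emb∁ A κ₁ κ₂ b′ = EdgeOK-> (E G _ _) (↑ˡ<↑ʳ (κ₁ b′) (κ₂ a′))
        (λ s⊎d → emb∁-∉ A b′ (closed _ _ (emb-∈ A a′) s⊎d))

count : ∀ {n M} → (Fin n → Fin M) → Fin M → ℕ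
count {n} κ c = ∑[ a < n ] 𝟙 (κ a ≟ c)

fibre≡count : ∀ {n M} (κ : Fin n → Fin M) c → fibre κ c ≡ count κ c
fibre≡count {n} κ c = trans (length-filter (λ a → κ a ≟ c) (allFin n)) (∑ₗ-tabulate n (λ a → a) _)

count-cong : ∀ {n M} {κ κ′ : Fin n → Fin M} → κ ≗ κ′ → ∀ c → count κ c ≡ count κ′ c
count-cong κ≗κ′ c = sum-cong-≗ λ a → 𝟙-cong (trans (sym (κ≗κ′ a))) (trans (κ≗κ′ a)) _ _

HasContent-cong : ∀ {n M} {κ κ′ : Fin n → Fin M} {α} → κ ≗ κ′ → HasContent κ α → HasContent κ′ α
HasContent-cong {κ = κ} {κ′} κ≗κ′ content c = begin
  fibre κ′ c  ≡⟨ fibre≡count κ′ c ⟩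
  count κ′ c  ≡⟨ count-cong κ≗κ′ c ⟨
  count κ c   ≡⟨ fibre≡count κ c ⟨
  fibre κ c   ≡⟨ content c ⟩
  _           ∎

module _ {m k : ℕ} where

  count-glueˡ : ∀ {n} (A : Subset n) κ₁ κ₂ (i : Fin m) → count (glue {m} {k} A κ₁ κ₂) (i ↑ˡ k) ≡ count κ₁ i
  count-glueˡ []          κ₁ κ₂ i = refl
  count-glueˡ (true ∷ A)  κ₁ κ₂ i = cong₂ _+_
    (𝟙-no (λ eq → <⇒≢ (↑ˡ<↑ʳ i (κ₂ zero)) (sym eq)) (m ↑ʳ κ₂ zero ≟ i ↑ˡ k))
    (count-glueˡ A κ₁ (λ j → κ₂ (suc j)) i)
  count-glueˡ (false ∷ A) κ₁ κ₂ i = cong₂ _+_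
    (𝟙-cong (↑ˡ-injective k _ _) (cong (_↑ˡ k)) _ _)
    (count-glueˡ A (λ j → κ₁ (suc j)) κ₂ i)

  count-glueʳ : ∀ {n} (A : Subset n) κ₁ κ₂ (j : Fin k) → count (glue {m} {k} A κ₁ κ₂) (m ↑ʳ j) ≡ count κ₂ j
  count-glueʳ []          κ₁ κ₂ j = refl
  count-glueʳ (true ∷ A)  κ₁ κ₂ j = cong₂ _+_
    (𝟙-cong (↑ʳ-injective m _ _) (cong (m ↑ʳ_)) _ _)
    (count-glueʳ A κ₁ (λ i → κ₂ (suc i)) j)
  count-glueʳ (false ∷ A) κ₁ κ₂ j = cong₂ _+_
    (𝟙-no (λ eq → <⇒≢ (↑ˡ<↑ʳ (κ₁ zero) j) eq) (κ₁ zero ↑ˡ k ≟ m ↑ʳ j))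
    (count-glueʳ A (λ i → κ₁ (suc i)) κ₂ j)

  HasContent-++ : ∀ {n} (κ : Fin n → Fin (m + k)) (α : Fin m → ℕ) (β : Fin k → ℕ) →
    (∀ i → fibre κ (i ↑ˡ k) ≡ α i) → (∀ j → fibre κ (m ↑ʳ j) ≡ β j) → HasContent κ (α ++ β)
  HasContent-++ κ α β contentˡ contentʳ c with splitAt m c in eq
  ... | inj₁ i = trans (cong (fibre κ) (sym (splitAt⁻¹-↑ˡ eq))) (contentˡ i)
  ... | inj₂ j = trans (cong (fibre κ) (sym (splitAt⁻¹-↑ʳ eq))) (contentʳ j)

  module _ {n} (A : Subset n) (κ₁ : Fin (size (∁ A)) → Fin m) (κ₂ : Fin (size A) → Fin k)
           (α : Fin m → ℕ) (β : Fin k → ℕ) where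

    private
      fibre-glueˡ : ∀ i → fibre (glue A κ₁ κ₂) (i ↑ˡ k) ≡ fibre κ₁ i
      fibre-glueˡ i = trans (fibre≡count (glue A κ₁ κ₂) (i ↑ˡ k)) (trans (count-glueˡ A κ₁ κ₂ i) (sym (fibre≡count κ₁ i)))

      fibre-glueʳ : ∀ j → fibre (glue A κ₁ κ₂) (m ↑ʳ j) ≡ fibre κ₂ j
      fibre-glueʳ j = trans (fibre≡count (glue A κ₁ κ₂) (m ↑ʳ j)) (trans (count-glueʳ A κ₁ κ₂ j) (sym (fibre≡count κ₂ j)))

    content-glue⁻ : HasContent (glue A κ₁ κ₂) (α ++ β) → HasContent κ₁ α × HasContent κ₂ β
    content-glue⁻ content =
      (λ i → trans (sym (fibre-glueˡ i)) (trans (content (i ↑ˡ k)) (lookup-++ˡ α β i))) ,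
      (λ j → trans (sym (fibre-glueʳ j)) (trans (content (m ↑ʳ j)) (lookup-++ʳ α β j)))

    content-glue : HasContent κ₁ α → HasContent κ₂ β → HasContent (glue A κ₁ κ₂) (α ++ β)
    content-glue content₁ content₂ = HasContent-++ (glue A κ₁ κ₂) α β
      (λ i → trans (fibre-glueˡ i) (content₁ i)) (λ j → trans (fibre-glueʳ j) (content₂ j))

Proper-cong : ∀ (G : ECDigraph) {M} {κ κ′ : Fin (n G) → Fin M} → κ ≗ κ′ → Proper G κ → Proper G κ′
Proper-cong G κ≗κ′ proper a b = subst₂ (EdgeOK (E G a b)) (κ≗κ′ a) (κ≗κ′ b) (proper a b)

weight : ∀ (G : ECDigraph) {M} → (Fin M → ℕ) → (Fin (n G) → Fin M) → ℕ
weight G γ κ = 𝟙 (Proper? G κ ×-dec HasContent? κ γ)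

coeffX≡∑ₗ-weight : ∀ (G : ECDigraph) {M} (γ : Fin M → ℕ) → coeffX G γ ≡ ∑ₗ (allFuns (n G) M) (weight G γ)
coeffX≡∑ₗ-weight G {M} γ = length-filter _ (allFuns (n G) M)

weight-cong : ∀ (G : ECDigraph) {M} (γ : Fin M → ℕ) → weight G γ Preserves _≗_ ⟶ _≡_
weight-cong G γ κ≗κ′ = 𝟙-cong
  (λ (proper , content) → Proper-cong G κ≗κ′ proper , HasContent-cong κ≗κ′ content)
  (λ (proper , content) → Proper-cong G (sym ∘ κ≗κ′) proper , HasContent-cong (sym ∘ κ≗κ′) content)
  _ _

module _ {m k : ℕ} (G : ECDigraph) (α : Fin m → ℕ) (β : Fin k → ℕ) (A : Subset (n G)) where

  weight-glue : ∀ κ₁ κ₂ → weight G (α ++ β) (glue A κ₁ κ₂)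
    ≡ 𝟙 (ArrowClosed? G A) * weight (restrict G (∁ A)) α κ₁ * weight (restrict G A) β κ₂
  weight-glue κ₁ κ₂ = begin
    𝟙 (Proper? G γ ×-dec HasContent? γ (α ++ β))   ≡⟨ 𝟙-cong to from _ ((closed? ×-dec glued₁?) ×-dec glued₂?) ⟩
    𝟙 ((closed? ×-dec glued₁?) ×-dec glued₂?)      ≡⟨ 𝟙-× (closed? ×-dec glued₁?) glued₂? ⟩
    𝟙 (closed? ×-dec glued₁?) * 𝟙 glued₂?          ≡⟨ cong (_* 𝟙 glued₂?) (𝟙-× closed? glued₁?) ⟩
    𝟙 closed? * 𝟙 glued₁? * 𝟙 glued₂?              ∎
    where
    γ = glue A κ₁ κ₂
    closed? = ArrowClosed? G A
    glued₁? = Proper? (restrict G (∁ A)) κ₁ ×-dec HasContent? κ₁ α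
    glued₂? = Proper? (restrict G A) κ₂ ×-dec HasContent? κ₂ β

    to : Proper G γ × HasContent γ (α ++ β) →
         (ArrowClosed G A × Proper (restrict G (∁ A)) κ₁ × HasContent κ₁ α) × Proper (restrict G A) κ₂ × HasContent κ₂ β
    to (proper , content) with content-glue⁻ A κ₁ κ₂ α β content
    ... | content₁ , content₂ =
      (proper-glue⇒closed G A κ₁ κ₂ proper , proper-glue⇒properˡ G A κ₁ κ₂ proper , content₁) ,
      (proper-glue⇒properʳ G A κ₁ κ₂ proper , content₂)

    from : (ArrowClosed G A × Proper (restrict G (∁ A)) κ₁ × HasContent κ₁ α) × Proper (restrict G A) κ₂ × HasContent κ₂ β →
           Proper G γ × HasContent γ (α ++ β)
    from ((closed , proper₁ , content₁) , (proper₂ , content₂)) =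
      proper-glue G A κ₁ κ₂ closed proper₁ proper₂ , content-glue A κ₁ κ₂ α β content₁ content₂

  ∑-glue-weight : ∑-glue A (weight G (α ++ β))
    ≡ 𝟙 (ArrowClosed? G A) * (coeffX (restrict G (∁ A)) α * coeffX (restrict G A) β)
  ∑-glue-weight = begin
    ∑-glue A (weight G (α ++ β))
      ≡⟨ ∑ₗ-cong κ₁s (λ κ₁ → ∑ₗ-cong κ₂s (weight-glue κ₁)) ⟩
    ∑[ κ₁ ← κ₁s ] ∑[ κ₂ ← κ₂s ] (c * w₁ κ₁ * w₂ κ₂)
      ≡⟨ ∑ₗ-*-∑ₗ κ₁s κ₂s (λ κ₁ → c * w₁ κ₁) w₂ ⟩
    ∑[ κ₁ ← κ₁s ] (c * w₁ κ₁) * ∑ₗ κ₂s w₂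
      ≡⟨ cong (_* ∑ₗ κ₂s w₂) (*-distribˡ-∑ₗ c κ₁s w₁) ⟨
    c * ∑ₗ κ₁s w₁ * ∑ₗ κ₂s w₂
      ≡⟨ ℕ.*-assoc c _ _ ⟩
    c * (∑ₗ κ₁s w₁ * ∑ₗ κ₂s w₂)
      ≡⟨ cong (c *_) (cong₂ _*_ (coeffX≡∑ₗ-weight (restrict G (∁ A)) α) (coeffX≡∑ₗ-weight (restrict G A) β)) ⟨
    c * (coeffX (restrict G (∁ A)) α * coeffX (restrict G A) β) ∎
    where
    κ₁s = allFuns (size (∁ A)) m
    κ₂s = allFuns (size A) k
    c = 𝟙 (ArrowClosed? G A)
    w₁ = weight (restrict G (∁ A)) α
    w₂ = weight (restrict G A) β

mainTheorem1 : (G : ECDigraph) (m k : ℕ) (α : Fin m → ℕ) (β : Fin k → ℕ) →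
    ΔcoeffX G α β ≡ RHScoeff G α β
mainTheorem1 G m k α β = begin
  ΔcoeffX G α β
    ≡⟨ coeffX≡∑ₗ-weight G (α ++ β) ⟩
  ∑ₗ (allFuns (n G) (m + k)) (weight G (α ++ β))
    ≡⟨ ∑ₗ-allFuns-glue (n G) (weight G (α ++ β)) (weight-cong G (α ++ β)) ⟩
  ∑[ A ← allSubsets (n G) ] ∑-glue A (weight G (α ++ β))
    ≡⟨ ∑ₗ-cong (allSubsets (n G)) (∑-glue-weight G α β) ⟩
  ∑[ A ← allSubsets (n G) ] (𝟙 (ArrowClosed? G A) * (coeffX (restrict G (∁ A)) α * coeffX (restrict G A) β))
    ≡⟨ ∑ₗ-filter (ArrowClosed? G) (allSubsets (n G)) _ ⟨
  RHScoeff G α β ∎
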